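{- Let $T$ be a finite vertex-colored arborescence on $n$ vertices with vertex-colored Prüfer code $P$ having first row $(p_0,\dots,p_{n-1})$, and let $v_i$ be the vertex removed at step $i$ of the construction of $P$ (with $v_{n-1}$ the root). Let $0\le i<j\le n-1$. Then $(v_j,v_i)\in E(T)$ (i.e. $v_j$ is the parent of $v_i$) if and only if $p_j<p_i$ and $p_k\geq p_i$ for every integer $k$ with $i<k<j$.
   Context: A vertex-colored arborescence is a finite directed tree $T$ with a root $r$ such that every edge is directed away from $r$, together with a coloring $c:V(T)\to\mathbb{N}$ (not necessarily proper). For $v\in V(T)$, $T[v]$ is the subarborescence of $v$ and all its descendants. Arrays are compared lexicographically: $x<y$ iff there is an index $i$ with $x[j]=y[j]$ for all $j<i$ and either $x[i]<y[i]$ (entries being integers or arrays compared recursively), or $x$ has length $i$ while $y$ is longer. The array $\mathrm{L}\mathcal{D}_A$ is defined recursively: if $u$ has no children, $\mathrm{L}\mathcal{D}_A(T[u])=[[\,]]$; otherwise, list the children of $u$ as $n_1,\dots,n_k$ sorted so that $n_a$ precedes $n_b$ whenever $c(n_a)<c(n_b)$, or $c(n_a)=c(n_b)$ and $\mathrm{L}\mathcal{D}_A(T[n_a])<\mathrm{L}\mathcal{D}_A(T[n_b])$ (remaining ties broken arbitrarily), and set $\mathrm{L}\mathcal{D}_A(T[u])=[[c(n_1),\dots,c(n_k)]]+\mathrm{L}\mathcal{D}_A(T[n_1])+\cdots+\mathrm{L}\mathcal{D}_A(T[n_k])$ ($+$ is concatenation). Let $\phi:V(T)\to\{0,\dots,n-1\}$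 assign to each vertex its position in the preorder depth-first traversal from the root in which the children of every vertex are visited in this sorted order. The vertex-colored Prüfer code (VCPC) $P$ is the $2\times n$ array built as follows: for steps $i=0,\dots,n-2$, in the current tree remove the vertex $v_i$ of out-degree zero with smallest $\phi$-value, recording in column $i$ the value $p_i=\phi(\text{parent of }v_i)$ (first row) and $c(v_i)$ (second row); in the last column record $p_{n-1}=\emptyset$ and the color of the root $v_{n-1}$. In comparisons, $\emptyset$ is regarded as smaller than every integer. -}

module Defs where

open import Data.Nat using (ℕ; zero; suc; _+_; _<_; _≤_; _≡ᵇ_)
open import Data.Bool using (Bool; true; false; not; if_then_else_)
open import Data.List using (List; []; _∷_; _++_; length; upTo)
open import Data.Empty using (⊥)
open import Data.Unit using (⊤)
open import Data.List.Relation.Unary.All using (All)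
open import Data.List.Relation.Unary.AllPairs using (AllPairs)
open import Data.List.Relation.Binary.Lex.Strict using (Lex-<)
open import Data.Maybe using (Maybe; just; nothing)
open import Data.Product using (_×_; _,_)
open import Data.Sum using (_⊎_)
open import Relation.Binary.PropositionalEquality using (_≡_)
open import Relation.Nullary using (¬_)

data Tree : Set where
  node : ℕ → List Tree → Tree

color : Tree → ℕ
color (node c _) = c

colors : List Tree → List ℕ
colors [] = []
colors (node c _ ∷ ts) = c ∷ colors ts

-- LD_A, computed w.r.t. the *given* order of children
-- (meaningful when the tree is Sorted, see below).
mutual
  LD : Tree → List (List ℕ)
  LD (node c []) = [] ∷ []
  LD (node c (t ∷ ts)) = colors (t ∷ ts) ∷ LDs (t ∷ ts)

  LDs : List Tree → List (List ℕ)
  LDs [] = []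
  LDs (t ∷ ts) = LD t ++ LDs ts

_<LD_ : List (List ℕ) → List (List ℕ) → Set
_<LD_ = Lex-< _≡_ (Lex-< _≡_ _<_)

-- n_a must precede n_b whenever  KeyLt n_a n_b.
KeyLt : Tree → Tree → Set
KeyLt a b = color a < color b ⊎ (color a ≡ color b × LD a <LD LD b)

data Sorted : Tree → Set where
  sorted : ∀ c ts → AllPairs (λ x y → ¬ KeyLt y x) ts → All Sorted ts
         → Sorted (node c ts)

mutual
  size : Tree → ℕ
  size (node _ ts) = suc (sizes ts)

  sizes : List Tree → ℕ
  sizes [] = 0
  sizes (t ∷ ts) = size t + sizes ts

-- Preorder (children visited in list order).  Entry number k is the vertex
-- with φ-value k; the list stores φ(parent) (nothing for the root).
-- Arguments: φ-value of the current vertex, φ-value of its parent.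
mutual
  pre : ℕ → Maybe ℕ → Tree → List (Maybe ℕ)
  pre off par (node _ ts) = par ∷ pres (suc off) (just off) ts

  pres : ℕ → Maybe ℕ → List Tree → List (Maybe ℕ)
  pres off par [] = []
  pres off par (t ∷ ts) = pre off par t ++ pres (off + size t) par ts

nth : {A : Set} → A → List A → ℕ → A
nth d [] _ = d
nth d (x ∷ xs) zero = x
nth d (x ∷ xs) (suc k) = nth d xs k

parentOf : Tree → ℕ → Maybe ℕ
parentOf t v = nth nothing (pre 0 nothing t) v

eqM : Maybe ℕ → ℕ → Bool
eqM nothing _ = false
eqM (just a) b = a ≡ᵇ b

isLeaf : Tree → List ℕ → ℕ → Bool
isLeaf t R v = not (hasChild R)
  where
  hasChild : List ℕ → Bool
  hasChild [] = false
  hasChild (w ∷ ws) = if eqM (parentOf t w) v then true else hasChild ws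

firstLeaf : Tree → List ℕ → Maybe ℕ
firstLeaf t R = go R
  where
  go : List ℕ → Maybe ℕ
  go [] = nothing
  go (v ∷ vs) = if isLeaf t R v then just v else go vs

removeV : ℕ → List ℕ → List ℕ
removeV v [] = []
removeV v (w ∷ ws) = if w ≡ᵇ v then removeV v ws else w ∷ removeV v ws

-- Removal sequence (as φ-values), R kept in increasing φ order.
-- At each step remove the leaf of smallest φ; the last one removed is
-- the root (once it is the only remaining vertex).
removals : Tree → ℕ → List ℕ → List ℕ
removals t zero R = []
removals t (suc f) R with firstLeaf t R
... | nothing = []
... | just v  = v ∷ removals t f (removeV v R)

vtx : Tree → ℕ → ℕ
vtx t i = nth 0 (removals t (size t) (upTo (size t))) i

-- first row of the VCPC: p_i = φ(parent of v_i), nothing = ∅.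
pcode : Tree → ℕ → Maybe ℕ
pcode t i = parentOf t (vtx t i)

_<ₘ_ : Maybe ℕ → Maybe ℕ → Set
nothing <ₘ nothing = ⊥
nothing <ₘ just _ = ⊤
just _ <ₘ nothing = ⊥
just a <ₘ just b = a < b

_≤ₘ_ : Maybe ℕ → Maybe ℕ → Set
nothing ≤ₘ _ = ⊤
just _ ≤ₘ nothing = ⊥
just a ≤ₘ just b = a ≤ b

-- Vertices are identified with their preorder numbers φ.  In preorder, the vertices strictly
-- between a vertex and its parent lie in the parent's subtree, so every subtree is an interval.
-- Repeatedly removing the φ-least leaf removes the vertices in postorder: once v_i is gone,
-- every vertex removed before its parent v_j is a proper descendant of v_j, so its parent has
-- φ-value at least φ(v_j) = p_i, whereas p_j < φ(v_j) = p_i.  Conversely, the parent of v_i is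
-- removed at some step m > i, and m ≠ j is impossible: m < j would give p_m < φ(v_m) = p_i, and
-- m > j would give p_j ≥ p_i.

module Submission where

open import Defs
open import Data.Nat using (ℕ; zero; suc; _+_; _∸_; _<_; _≤_; z≤n; s≤s; _≟_; _≤?_; _≡ᵇ_)
open import Data.Nat.Properties
open import Data.Nat.Induction using (<-wellFounded)
open import Data.Bool using (true; false; not; if_then_else_; T)
open import Data.Bool.Properties using (not-injective)
open import Data.Bool.ListAction using (any)
open import Data.Empty using (⊥-elim)
open import Data.List using (List; []; _∷_; _++_; length; upTo; filter)
open import Data.List.Properties using (length-++; length-upTo; filter-accept; filter-reject; filter-all)
open import Data.List.Membership.Propositional using (_∈_; _∉_; find; lose)
open import Data.List.Membership.Propositional.Properties using (∈-filter⁻; ∈-filter⁺; ∈-upTo⁺; ∈-upTo⁻)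
open import Data.List.Relation.Unary.Any using (here; there)
open import Data.List.Relation.Unary.Any.Properties using (any⁺; any⁻)
import Data.List.Relation.Unary.All as All
open import Data.List.Relation.Unary.AllPairs using (AllPairs; _∷_)
import Data.List.Relation.Unary.AllPairs.Properties as AllPairs
open import Data.Maybe using (Maybe; just; nothing)
open import Data.Maybe.Properties using (just-injective)
open import Data.Product using (_×_; _,_; proj₁; proj₂; ∃-syntax; map₂)
open import Data.Sum using (_⊎_; inj₁; inj₂)
open import Data.Unit using (tt)
open import Function using (_∘_; case_of_)
open import Function.Bundles using (_⇔_; mk⇔)
open import Induction.WellFounded using (Acc; acc)
open import Relation.Binary.Definitions using (tri<; tri≈; tri>)
open import Relation.Binary.PropositionalEquality using (_≡_; _≢_; refl; sym; trans; cong; cong₂; subst)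
open import Relation.Nullary using (¬_; Dec; ¬?; yes; no)

module _ {A : Set} (d : A) where

  nth-++ˡ : ∀ xs {ys k} → k < length xs → nth d (xs ++ ys) k ≡ nth d xs k
  nth-++ˡ (x ∷ xs) {k = zero}  _          = refl
  nth-++ˡ (x ∷ xs) {k = suc k} (s≤s k<n) = nth-++ˡ xs k<n

  nth-++ʳ : ∀ xs {ys} k → nth d (xs ++ ys) (length xs + k) ≡ nth d ys k
  nth-++ʳ []       k = refl
  nth-++ʳ (x ∷ xs) k = nth-++ʳ xs k

  nth-∈ : ∀ {xs k} → k < length xs → nth d xs k ∈ xs
  nth-∈ {x ∷ xs} {zero}  _          = here refl
  nth-∈ {x ∷ xs} {suc k} (s≤s k<n) = there (nth-∈ k<n)

  ∈⇒nth : ∀ {xs x} → x ∈ xs → ∃[ k ] k < length xs × nth d xs k ≡ x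
  ∈⇒nth (here refl) = 0 , s≤s z≤n , refl
  ∈⇒nth (there x∈xs) with k , k<n , xₖ≡x ← ∈⇒nth x∈xs = suc k , s≤s k<n , xₖ≡x

nth-just⇒< : ∀ {B : Set} xs {k} {b : B} → nth nothing xs k ≡ just b → k < length xs
nth-just⇒< (x ∷ xs) {zero}  _ = s≤s z≤n
nth-just⇒< (x ∷ xs) {suc k} h = s≤s (nth-just⇒< xs h)

data Split (s : ℕ) : ℕ → Set where
  inside : ∀ {d} → d < s → Split s d
  beyond : ∀ e → Split s (s + e)

split : ∀ s d → Split s d
split zero    d       = beyond d
split (suc s) zero    = inside (s≤s z≤n)
split (suc s) (suc d) with split s d
... | inside d<s = inside (s≤s d<s)
... | beyond e   = beyond e

-- Entry d of `pre off par t` is the parent of the vertex numbered off + d.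
_!_ : List (Maybe ℕ) → ℕ → Maybe ℕ
xs ! d = nth nothing xs d

mutual
  length-pre : ∀ off par t → length (pre off par t) ≡ size t
  length-pre off par (node _ ts) = cong suc (length-pres (suc off) (just off) ts)

  length-pres : ∀ off par ts → length (pres off par ts) ≡ sizes ts
  length-pres off par []       = refl
  length-pres off par (t ∷ ts) = trans (length-++ (pre off par t))
    (cong₂ _+_ (length-pre off par t) (length-pres (off + size t) par ts))

pres-∷ˡ : ∀ off par t ts {d} → d < size t → pres off par (t ∷ ts) ! d ≡ pre off par t ! d
pres-∷ˡ off par t ts {d} d<s =
  nth-++ˡ nothing (pre off par t) (subst (d <_) (sym (length-pre off par t)) d<s)

pres-∷ʳ : ∀ off par t ts e →
          pres off par (t ∷ ts) ! (size t + e) ≡ pres (off + size t) par ts ! e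
pres-∷ʳ off par t ts e rewrite sym (length-pre off par t) = nth-++ʳ nothing (pre off par t) e

mutual
  pre-entry : ∀ off par t d {q} → pre off par t ! suc d ≡ just q → off ≤ q × q < off + suc d
  pre-entry off par (node _ ts) d {q} h with pres-entry (suc off) off ts d h
  ... | inj₁ refl          = ≤-refl , m<m+n off (s≤s z≤n)
  ... | inj₂ (off<q , q<) = <⇒≤ off<q , subst (q <_) (sym (+-suc off d)) q<

  subtree-entry : ∀ off r t {x q} → pre off (just r) t ! x ≡ just q →
                  q ≡ r ⊎ (off ≤ q × q < off + x)
  subtree-entry off r (node _ _) {zero}  refl = inj₁ refl
  subtree-entry off r t          {suc x} h    = inj₂ (pre-entry off (just r) t x h)

  pres-entry : ∀ off r ts d {q} → pres off (just r) ts ! d ≡ just q →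
               q ≡ r ⊎ (off ≤ q × q < off + d)
  pres-entry off r (t ∷ ts) d {q} h with split (size t) d
  ... | inside d<s = subtree-entry off r t (trans (sym (pres-∷ˡ off (just r) t ts d<s)) h)
  ... | beyond e with pres-entry (off + size t) r ts e (trans (sym (pres-∷ʳ off (just r) t ts e)) h)
  ...   | inj₁ q≡r            = inj₁ q≡r
  ...   | inj₂ (off+s≤q , q<) =
    inj₂ (≤-trans (m≤m+n off (size t)) off+s≤q , subst (q <_) (+-assoc off (size t) e) q<)

pres-total : ∀ off r ts {d} → d < sizes ts → ∃[ q ] pres off (just r) ts ! d ≡ just q
pres-total off r (t ∷ ts) {d} d<n with split (size t) d
pres-total off r (node _ _ ∷ ts) {zero} _ | inside _ = r , refl
pres-total off r (t@(node _ us) ∷ ts) {suc d} _ | inside (s≤s d<s) =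
  map₂ (trans (pres-∷ˡ off (just r) t ts (s≤s d<s))) (pres-total (suc off) off us d<s)
pres-total off r (t ∷ ts) d<n | beyond e =
  map₂ (trans (pres-∷ʳ off (just r) t ts e))
       (pres-total (off + size t) r ts (+-cancelˡ-< (size t) e (sizes ts) d<n))

mutual
  pre-nested : ∀ off par t {x d q q′} → x < d → pre off par t ! d ≡ just q → q < off + x →
               pre off par t ! x ≡ just q′ → q ≤ q′
  pre-nested off par t {zero} {suc d} _ hd q<off+0 _ =
    ⊥-elim (<⇒≱ q<off+0 (subst (_≤ _) (sym (+-identityʳ off)) (proj₁ (pre-entry off par t d hd))))
  pre-nested off par (node _ ts) {suc x} {suc d} {q} (s≤s x<d) hd q< hx =
    pres-nested (suc off) off ts (n≤1+n off) x<d hd (subst (q <_) (+-suc off x) q<) hx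

  pres-nested : ∀ off r ts {x d q q′} → r ≤ off → x < d → pres off (just r) ts ! d ≡ just q →
                q < off + x → pres off (just r) ts ! x ≡ just q′ → q ≤ q′
  pres-nested off r (t ∷ ts) {x} {d} {q} r≤off x<d hd q< hx with split (size t) d | split (size t) x
  ... | inside d<s | _ =
    pre-nested off (just r) t x<d (trans (sym (pres-∷ˡ off (just r) t ts d<s)) hd) q<
      (trans (sym (pres-∷ˡ off (just r) t ts (<-trans x<d d<s))) hx)
  ... | beyond e | beyond e′ =
    pres-nested (off + size t) r ts (≤-trans r≤off (m≤m+n off (size t))) (+-cancelˡ-< (size t) e′ e x<d)
      (trans (sym (pres-∷ʳ off (just r) t ts e)) hd) (subst (q <_) (sym (+-assoc off (size t) e′)) q<)
      (trans (sym (pres-∷ʳ off (just r) t ts e′)) hx)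
  ... | beyond e | inside x<s
      with pres-entry (off + size t) r ts e (trans (sym (pres-∷ʳ off (just r) t ts e)) hd)
         | subtree-entry off r t (trans (sym (pres-∷ˡ off (just r) t ts x<s)) hx)
  ...   | inj₂ (off+s≤q , _) | _                = ⊥-elim (<⇒≱ (<-trans q< (+-monoʳ-< off x<s)) off+s≤q)
  ...   | inj₁ refl          | inj₁ refl        = ≤-refl
  ...   | inj₁ refl          | inj₂ (off≤q′ , _) = ≤-trans r≤off off≤q′

parent-< : ∀ t {w p} → parentOf t w ≡ just p → p < w
parent-< (node _ _) {zero} ()
parent-< t {suc d} h = proj₂ (pre-entry 0 nothing t d h)

parent-<ₘ : ∀ t v → parentOf t v <ₘ just v
parent-<ₘ t v with parentOf t v in pv
... | nothing = tt
... | just p  = parent-< t pv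

parent-total : ∀ t {x} → 0 < x → x < size t → ∃[ q ] parentOf t x ≡ just q
parent-total (node _ ts) {suc x} _ x<n = pres-total 1 0 ts (≤-pred x<n)

parent-nested : ∀ t {w p x} → parentOf t w ≡ just p → p < x → x < w →
                ∃[ q ] parentOf t x ≡ just q × p ≤ q
parent-nested t {w} {x = x} h p<x x<w =
  map₂ (λ hx → hx , pre-nested 0 nothing t x<w h p<x hx) (parent-total t (≤-<-trans z≤n p<x) x<n)
  where
  x<n : x < size t
  x<n = <-trans x<w (subst (w <_) (length-pre 0 nothing t) (nth-just⇒< (pre 0 nothing t) h))

eqM-sound : ∀ {m v} → T (eqM m v) → m ≡ just v
eqM-sound {just a} {v} h = cong just (≡ᵇ⇒≡ a v h)

eqM-complete : ∀ {m v} → m ≡ just v → T (eqM m v)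
eqM-complete {v = v} refl = ≡⇒≡ᵇ v v refl

_≢?_ : ∀ w v → Dec (w ≢ v)
w ≢? v = ¬? (w ≟ v)

removeV≡filter : ∀ v R → removeV v R ≡ filter (_≢? v) R
removeV≡filter v []       = refl
removeV≡filter v (w ∷ ws) with w ≡ᵇ v
... | true  = removeV≡filter v ws
... | false = cong (w ∷_) (removeV≡filter v ws)

∈-removeV⁻ : ∀ {x v R} → x ∈ removeV v R → x ∈ R × x ≢ v
∈-removeV⁻ {v = v} {R} rewrite removeV≡filter v R = ∈-filter⁻ (_≢? v)

∈-removeV⁺ : ∀ {x v R} → x ∈ R → x ≢ v → x ∈ removeV v R
∈-removeV⁺ {v = v} {R} rewrite removeV≡filter v R = ∈-filter⁺ (_≢? v)

removeV-sorted : ∀ {v R} → AllPairs _<_ R → AllPairs _<_ (removeV v R)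
removeV-sorted {v} {R} rewrite removeV≡filter v R = AllPairs.filter⁺ (_≢? v)

length-removeV : ∀ {v R} → v ∈ R → AllPairs _<_ R → suc (length (removeV v R)) ≡ length R
length-removeV {v} {R} v∈R asc rewrite removeV≡filter v R = go v∈R asc
  where
  go : ∀ {R} → v ∈ R → AllPairs _<_ R → suc (length (filter (_≢? v) R)) ≡ length R
  go (here refl) (v< ∷ _) = cong (suc ∘ length) (trans
    (filter-reject (_≢? v) (λ v≢v → v≢v refl))
    (filter-all (_≢? v) (All.map (λ v<w w≡v → <⇒≢ v<w (sym w≡v)) v<)))
  go (there v∈ws) (w< ∷ asc) = trans
    (cong (suc ∘ length) (filter-accept (_≢? v) (<⇒≢ (All.lookup w< v∈ws))))
    (cong suc (go v∈ws asc))

<ₘ⇒≱ₘ : ∀ {a b} → a <ₘ b → ¬ (b ≤ₘ a)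
<ₘ⇒≱ₘ {nothing} {just _} _ ()
<ₘ⇒≱ₘ {just a}  {just b} a<b b≤a = <⇒≱ a<b b≤a

module _ (t : Tree) where

  infix 4 _≼_ _≺_

  data _≼_ (u : ℕ) : ℕ → Set where
    self  : u ≼ u
    child : ∀ {w p} → parentOf t w ≡ just p → u ≼ p → u ≼ w

  _≺_ : ℕ → ℕ → Set
  u ≺ w = ∃[ p ] parentOf t w ≡ just p × u ≼ p

  ≼⇒≤ : ∀ {u w} → u ≼ w → u ≤ w
  ≼⇒≤ self            = ≤-refl
  ≼⇒≤ (child pw u≼p) = ≤-trans (≼⇒≤ u≼p) (<⇒≤ (parent-< t pw))

  ≼-trans : ∀ {u v w} → u ≼ v → v ≼ w → u ≼ w
  ≼-trans u≼v self            = u≼v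
  ≼-trans u≼v (child pw v≼p) = child pw (≼-trans u≼v v≼p)

  ≼∧≢⇒≺ : ∀ {u w} → u ≼ w → u ≢ w → u ≺ w
  ≼∧≢⇒≺ self            u≢u = ⊥-elim (u≢u refl)
  ≼∧≢⇒≺ (child pw u≼p) _   = _ , pw , u≼p

  ≺⇒≤ₘ : ∀ {u w} → u ≺ w → just u ≤ₘ parentOf t w
  ≺⇒≤ₘ (p , pw , u≼p) rewrite pw = ≼⇒≤ u≼p

  parent-≼-between : ∀ {w p x} → parentOf t w ≡ just p → p < x → x < w → p ≼ x
  parent-≼-between {w} {p} pw = go (<-wellFounded _)
    where
    go : ∀ {x} → Acc _<_ x → p < x → x < w → p ≼ x
    go (acc smaller) p<x x<w with q , px , p≤q ← parent-nested t pw p<x x<w with m≤n⇒m<n∨m≡n p≤q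
    ... | inj₂ refl = child px self
    ... | inj₁ p<q  = child px (go (smaller (parent-< t px)) p<q (<-trans (parent-< t px) x<w))

  ≼-convex : ∀ {u a b x} → u ≼ a → u ≼ b → a ≤ x → x ≤ b → u ≼ x
  ≼-convex u≼a self a≤x x≤u with ≤-antisym x≤u (≤-trans (≼⇒≤ u≼a) a≤x)
  ... | refl = self
  ≼-convex {x = x} u≼a (child {p = p} pb u≼p) a≤x x≤b with x ≤? p | m≤n⇒m<n∨m≡n x≤b
  ... | yes x≤p | _         = ≼-convex u≼a u≼p a≤x x≤p
  ... | no  _   | inj₂ refl = child pb u≼p
  ... | no  x≰p | inj₁ x<b  = ≼-trans u≼p (parent-≼-between pb (≰⇒> x≰p) x<b)

  Leaf : List ℕ → ℕ → Set
  Leaf R v = ∀ {w} → w ∈ R → parentOf t w ≢ just v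

  firstLeafAmong : List ℕ → List ℕ → Maybe ℕ
  firstLeafAmong R []       = nothing
  firstLeafAmong R (v ∷ vs) = if isLeaf t R v then just v else firstLeafAmong R vs

  -- `isLeaf` and `firstLeaf` scan R with functions local to their where-blocks.  The underscores
  -- below stand for those functions; unification solves them from the calls, in which `with`
  -- has made the R they are parametrised by a variable distinct from the list being scanned.
  -- (`with` normalises the goal, which would unfold `findᵇ (isLeaf t R)`; hence `firstLeafAmong`.)
  mutual
    isLeaf≡ : ∀ R v → isLeaf t R v ≡ not (any (λ w → eqM (parentOf t w) v) R)
    isLeaf≡ []       v = refl
    isLeaf≡ (w ∷ ws) v with w ∷ ws | eqM (parentOf t w) v
    ... | R | true  = refl
    ... | R | false = cong not (hasChild≡any R v ws)

    hasChild≡any : ∀ R v ws → _ ≡ any (λ w → eqM (parentOf t w) v) ws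
    hasChild≡any R v []       = refl
    hasChild≡any R v (w ∷ ws) with eqM (parentOf t w) v
    ... | true  = refl
    ... | false = hasChild≡any R v ws

  mutual
    firstLeaf≡ : ∀ R → firstLeaf t R ≡ firstLeafAmong R R
    firstLeaf≡ []       = refl
    firstLeaf≡ (w ∷ ws) with w ∷ ws
    ... | R = cong (if_then_else_ _ (just w)) (scan≡ R ws)

    scan≡ : ∀ R vs → _ ≡ firstLeafAmong R vs
    scan≡ R []       = refl
    scan≡ R (v ∷ vs) = cong (if_then_else_ _ (just v)) (scan≡ R vs)

  isLeaf-sound : ∀ {R v} → isLeaf t R v ≡ true → Leaf R v
  isLeaf-sound {R} {v} h w∈R pw =
    subst T (not-injective (trans (sym (isLeaf≡ R v)) h)) (any⁺ _ (lose w∈R (eqM-complete pw)))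

  isLeaf-false : ∀ {R v} → isLeaf t R v ≡ false → ∃[ w ] w ∈ R × parentOf t w ≡ just v
  isLeaf-false {R} {v} h = map₂ (map₂ eqM-sound) (find (any⁻ _ R has-child))
    where
    has-child : T (any (λ w → eqM (parentOf t w) v) R)
    has-child = subst T (sym (not-injective (trans (sym (isLeaf≡ R v)) h))) tt

  isLeaf-complete : ∀ {R v} → Leaf R v → isLeaf t R v ≡ true
  isLeaf-complete {R} {v} v-leaf with isLeaf t R v in h
  ... | true  = refl
  ... | false with w , w∈R , pw ← isLeaf-false h = ⊥-elim (v-leaf w∈R pw)

  firstLeafAmong-just : ∀ {R vs l} → AllPairs _<_ vs → firstLeafAmong R vs ≡ just l →
                        l ∈ vs × Leaf R l × (∀ {y} → y ∈ vs → Leaf R y → l ≤ y)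
  firstLeafAmong-just {R} {v ∷ vs} (v< ∷ asc) h with isLeaf t R v in v-leaf
  ... | true with refl ← h = here refl , isLeaf-sound v-leaf , λ where
    (here refl)  _ → ≤-refl
    (there y∈vs) _ → <⇒≤ (All.lookup v< y∈vs)
  ... | false with l∈vs , l-leaf , l-least ← firstLeafAmong-just asc h = there l∈vs , l-leaf , λ where
    (here refl)  y-leaf → case trans (sym v-leaf) (isLeaf-complete y-leaf) of λ ()
    (there y∈vs) y-leaf → l-least y∈vs y-leaf

  firstLeafAmong-nothing : ∀ {R vs y} → firstLeafAmong R vs ≡ nothing → y ∈ vs → ¬ Leaf R y
  firstLeafAmong-nothing {R} {v ∷ vs} h y∈vs y-leaf with isLeaf t R v in v-leaf | y∈vs
  ... | false | here refl    = case trans (sym v-leaf) (isLeaf-complete y-leaf) of λ ()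
  ... | false | there y∈vs′ = firstLeafAmong-nothing h y∈vs′ y-leaf

  record LeastLeaf (R : List ℕ) (l : ℕ) : Set where
    field
      member : l ∈ R
      leaf   : Leaf R l
      least  : ∀ {y} → y ∈ R → Leaf R y → l ≤ y

  open LeastLeaf

  firstLeaf-least : ∀ {R l} → AllPairs _<_ R → firstLeaf t R ≡ just l → LeastLeaf R l
  firstLeaf-least {R} asc h
    with l∈R , l-leaf , l-least ← firstLeafAmong-just asc (trans (sym (firstLeaf≡ R)) h) =
    record { member = l∈R ; leaf = l-leaf ; least = l-least }

  firstLeaf-nothing : ∀ {R y} → firstLeaf t R ≡ nothing → y ∈ R → ¬ Leaf R y
  firstLeaf-nothing {R} h = firstLeafAmong-nothing (trans (sym (firstLeaf≡ R)) h)

  -- The removed vertices form an initial segment of the postorder.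
  record Invariant (R : List ℕ) : Set where
    field
      ascending     : AllPairs _<_ R
      bounded       : ∀ {y} → y ∈ R → y < size t
      closed        : ∀ {w p} → w ∈ R → parentOf t w ≡ just p → p ∈ R
      removed-below : ∀ {x y} → x < size t → x ∉ R → y ∈ R → y < x → y ≼ x

  open Invariant

  invariant-init : Invariant (upTo (size t))
  invariant-init = record
    { ascending     = AllPairs.applyUpTo⁺₁ (λ i → i) (size t) (λ i<j _ → i<j)
    ; bounded       = ∈-upTo⁻
    ; closed        = λ w∈R pw → ∈-upTo⁺ (<-trans (parent-< t pw) (∈-upTo⁻ w∈R))
    ; removed-below = λ x<n x∉R _ _ → ⊥-elim (x∉R (∈-upTo⁺ x<n))
    }

  leaf-below : ∀ {R y} → Invariant R → y ∈ R → ∃[ l ] l ∈ R × Leaf R l × y ≼ l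
  leaf-below {R} {y} inv = go (<-wellFounded (size t ∸ y))
    where
    closer : ∀ {y c} → parentOf t c ≡ just y → c ∈ R → size t ∸ c < size t ∸ y
    closer pc c∈R = ∸-monoʳ-< (parent-< t pc) (<⇒≤ (bounded inv c∈R))

    go : ∀ {y} → Acc _<_ (size t ∸ y) → y ∈ R → ∃[ l ] l ∈ R × Leaf R l × y ≼ l
    go {y} (acc smaller) y∈R with isLeaf t R y in y-leaf
    ... | true = y , y∈R , isLeaf-sound y-leaf , self
    ... | false with c , c∈R , pc ← isLeaf-false y-leaf
                with l , l∈R , l-leaf , c≼l ← go (smaller (closer pc c∈R)) c∈R
                = l , l∈R , l-leaf , ≼-trans (child pc self) c≼l

  leaf-≼⇒≡ : ∀ {R l u} → Invariant R → Leaf R l → u ∈ R → l ≼ u → l ≡ u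
  leaf-≼⇒≡ inv l-leaf u∈R self = refl
  leaf-≼⇒≡ inv l-leaf u∈R (child pu l≼p)
    with refl ← leaf-≼⇒≡ inv l-leaf (closed inv u∈R pu) l≼p = ⊥-elim (l-leaf u∈R pu)

  invariant-step : ∀ {R l} → Invariant R → LeastLeaf R l → Invariant (removeV l R)
  invariant-step {R} {l} inv ll = record
    { ascending     = removeV-sorted (ascending inv)
    ; bounded       = bounded inv ∘ proj₁ ∘ ∈-removeV⁻
    ; closed        = closed′
    ; removed-below = removed-below′
    }
    where
    closed′ : ∀ {w p} → w ∈ removeV l R → parentOf t w ≡ just p → p ∈ removeV l R
    closed′ w∈R′ pw with w∈R , _ ← ∈-removeV⁻ w∈R′ =
      ∈-removeV⁺ (closed inv w∈R pw) (λ { refl → leaf ll w∈R pw })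

    removed-below′ : ∀ {x y} → x < size t → x ∉ removeV l R → y ∈ removeV l R → y < x → y ≼ x
    removed-below′ {x} x<n x∉R′ y∈R′ y<x with y∈R , _ ← ∈-removeV⁻ y∈R′ with x ≟ l
    ... | yes refl with l₀ , l₀∈R , l₀-leaf , y≼l₀ ← leaf-below inv y∈R =
      ≼-convex self y≼l₀ (<⇒≤ y<x) (least ll l₀∈R l₀-leaf)
    ... | no x≢l = removed-below inv x<n (λ x∈R → x∉R′ (∈-removeV⁺ x∈R x≢l)) y∈R y<x

  -- If l < x, then x, and with it u, would lie below the leaf l; otherwise l lies between
  -- x and a leaf below u.
  least-leaf-in-parent-subtree : ∀ {R l x u} → Invariant R → LeastLeaf R l → x < size t → x ∉ R →
                                 parentOf t x ≡ just u → u ∈ R → u ≢ l → u ≺ l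
  least-leaf-in-parent-subtree {R} {l} {x} inv ll x<n x∉R px u∈R u≢l
    with l₀ , l₀∈R , l₀-leaf , u≼l₀ ← leaf-below inv u∈R
    with <-cmp l x
  ... | tri≈ _ refl _ = ⊥-elim (x∉R (member ll))
  ... | tri> _ _ x<l  =
    ≼∧≢⇒≺ (≼-convex (child px self) u≼l₀ (<⇒≤ x<l) (least ll l₀∈R l₀-leaf)) u≢l
  ... | tri< l<x _ _
    with p , px′ , l≼p ← ≼∧≢⇒≺ (removed-below inv x<n x∉R (member ll) l<x)
                                (λ { refl → x∉R (member ll) })
    with refl ← just-injective (trans (sym px′) px) =
    ⊥-elim (u≢l (sym (leaf-≼⇒≡ inv (leaf ll) u∈R l≼p)))

  data Removal : List ℕ → List ℕ → Set where
    done : Removal [] []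
    step : ∀ {R l s} → LeastLeaf R l → Removal (removeV l R) s → Removal R (l ∷ s)

  removals-removal : ∀ f {R} → Invariant R → length R ≤ f → Removal R (removals t f R)
  removals-removal zero    {[]}    _   _   = done
  removals-removal (suc f) {R}     inv R≤f with firstLeaf t R in first
  removals-removal (suc f) {[]}    inv R≤f | nothing = done
  removals-removal (suc f) {y ∷ R} inv R≤f | nothing
    with l , l∈R , l-leaf , _ ← leaf-below inv (here refl) = ⊥-elim (firstLeaf-nothing first l∈R l-leaf)
  ... | just l = step ll (removals-removal f (invariant-step inv ll) R′≤f)
    where
    ll : LeastLeaf R l
    ll = firstLeaf-least (ascending inv) first
    R′≤f : length (removeV l R) ≤ f
    R′≤f = ≤-pred (subst (_≤ suc f) (sym (length-removeV (member ll) (ascending inv))) R≤f)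

  removal-⊆ : ∀ {R s x} → Removal R s → x ∈ s → x ∈ R
  removal-⊆ (step ll _)   (here refl) = member ll
  removal-⊆ (step _ rest) (there x∈s) = proj₁ (∈-removeV⁻ (removal-⊆ rest x∈s))

  removal-complete : ∀ {R s x} → Removal R s → x ∈ R → x ∈ s
  removal-complete {x = x} (step {l = l} _ rest) x∈R with x ≟ l
  ... | yes refl = here refl
  ... | no x≢l   = there (removal-complete rest (∈-removeV⁺ x∈R x≢l))

  removal-length : ∀ {R s} → AllPairs _<_ R → Removal R s → length s ≡ length R
  removal-length _   done            = refl
  removal-length asc (step ll rest) =
    trans (cong suc (removal-length (removeV-sorted asc) rest)) (length-removeV (member ll) asc)

  removal-parent-later : ∀ {R s i u} → Invariant R → Removal R s → i < length s →
                         parentOf t (nth 0 s i) ≡ just u →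
                         ∃[ m ] i < m × m < length s × nth 0 s m ≡ u
  removal-parent-later {R} {l ∷ _} {zero} {u} inv (step ll rest) _ pl =
    let m , m<n , sₘ≡u = ∈⇒nth 0 (removal-complete rest u∈R′)
    in  suc m , s≤s z≤n , s≤s m<n , sₘ≡u
    where
    u∈R′ : u ∈ removeV l R
    u∈R′ = ∈-removeV⁺ (closed inv (member ll) pl) (λ u≡l → <-irrefl u≡l (parent-< t pl))
  removal-parent-later {i = suc i} inv (step ll rest) (s≤s i<n) pi
    with m , i<m , m<n , sₘ≡u ← removal-parent-later (invariant-step inv ll) rest i<n pi =
    suc m , s≤s i<m , s≤s m<n , sₘ≡u

  removed-while-parent-waits : ∀ {R s x u k m} → Invariant R → Removal R s → x < size t → x ∉ R →
                               parentOf t x ≡ just u → k < m → m < length s → nth 0 s m ≡ u →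
                               u ≺ nth 0 s k
  removed-while-parent-waits {k = zero} {suc m} inv (step ll rest) x<n x∉R px _ (s≤s m<n) refl
    with u∈R , u≢l ← ∈-removeV⁻ (removal-⊆ rest (nth-∈ 0 m<n)) =
    least-leaf-in-parent-subtree inv ll x<n x∉R px u∈R u≢l
  removed-while-parent-waits {k = suc k} {suc m} inv (step ll rest) x<n x∉R px (s≤s k<m) (s≤s m<n) sₘ≡u =
    removed-while-parent-waits (invariant-step inv ll) rest x<n (x∉R ∘ proj₁ ∘ ∈-removeV⁻)
      px k<m m<n sₘ≡u

  removal-between : ∀ {R s i k m} → Invariant R → Removal R s → i < k → k < m → m < length s →
                    parentOf t (nth 0 s i) ≡ just (nth 0 s m) → nth 0 s m ≺ nth 0 s k
  removal-between {R} {i = zero} {suc k} {suc m} inv (step ll rest) _ (s≤s k<m) (s≤s m<n) pl =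
    removed-while-parent-waits (invariant-step inv ll) rest (bounded inv (member ll))
      (λ l∈R′ → proj₂ (∈-removeV⁻ {R = R} l∈R′) refl) pl k<m m<n refl
  removal-between {i = suc i} {suc k} {suc m} inv (step ll rest) (s≤s i<k) (s≤s k<m) (s≤s m<n) pi =
    removal-between (invariant-step inv ll) rest i<k k<m m<n pi

  full-removal : Removal (upTo (size t)) (removals t (size t) (upTo (size t)))
  full-removal = removals-removal (size t) invariant-init (≤-reflexive (length-upTo (size t)))

  length-removals : length (removals t (size t) (upTo (size t))) ≡ size t
  length-removals = trans (removal-length (ascending invariant-init) full-removal) (length-upTo (size t))

  <size⇒<length : ∀ {i} → i < size t → i < length (removals t (size t) (upTo (size t)))
  <size⇒<length {i} = subst (i <_) (sym length-removals)

  vtx-parent-later : ∀ {i u} → i < size t → parentOf t (vtx t i) ≡ just u →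
                     ∃[ m ] i < m × m < size t × vtx t m ≡ u
  vtx-parent-later i<n pi
    with m , i<m , m<len , vₘ≡u ←
           removal-parent-later invariant-init full-removal (<size⇒<length i<n) pi =
    m , i<m , subst (m <_) length-removals m<len , vₘ≡u

  pcode-between : ∀ {i k j} → i < k → k < j → j < size t → parentOf t (vtx t i) ≡ just (vtx t j) →
                  pcode t i ≤ₘ pcode t k
  pcode-between i<k k<j j<n pi rewrite pi =
    ≺⇒≤ₘ (removal-between invariant-init full-removal i<k k<j (<size⇒<length j<n) pi)

lemma4p4 : (t : Tree) → Sorted t → (i j : ℕ) → i < j → j < size t →
    (parentOf t (vtx t i) ≡ just (vtx t j))
      ⇔ (pcode t j <ₘ pcode t i × ((k : ℕ) → i < k → k < j → pcode t i ≤ₘ pcode t k))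
lemma4p4 t _ i j i<j j<n = mk⇔ parent⇒code code⇒parent
  where
  Code : Set
  Code = pcode t j <ₘ pcode t i × ((k : ℕ) → i < k → k < j → pcode t i ≤ₘ pcode t k)

  parent⇒code : parentOf t (vtx t i) ≡ just (vtx t j) → Code
  parent⇒code pi = subst (pcode t j <ₘ_) (sym pi) (parent-<ₘ t (vtx t j))
                 , λ k i<k k<j → pcode-between t i<k k<j j<n pi

  code⇒parent : Code → parentOf t (vtx t i) ≡ just (vtx t j)
  code⇒parent (pⱼ<pᵢ , pᵢ≤) with pcode t i in pi
  ... | nothing = ⊥-elim (<ₘ⇒≱ₘ pⱼ<pᵢ tt)
  ... | just u with m , i<m , m<n , refl ← vtx-parent-later t (<-trans i<j j<n) pi with <-cmp m j
  ...   | tri≈ _ refl _ = refl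
  ...   | tri< m<j _ _  = ⊥-elim (<ₘ⇒≱ₘ (parent-<ₘ t (vtx t m)) (pᵢ≤ m i<m m<j))
  ...   | tri> _ _ j<m  =
    ⊥-elim (<ₘ⇒≱ₘ pⱼ<pᵢ (subst (_≤ₘ pcode t j) pi (pcode-between t i<j j<m m<n pi)))
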